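{- Let $G$ be a finite abelian group and $S\subseteq G$. Then the $2$-PCayley graph $\mathrm{BCay}(G,S)$ is $2$PCI if and only if it is K$2$PCI.
   Context: For $S\subseteq G$, $\mathrm{BCay}(G,S)$ is the bipartite graph with vertex set $G_1\cup G_2$, $G_i=\{x_i:x\in G\}$ two disjoint copies of $G$, and edges $\{x_1,(sx)_2\}$ for $s\in S$, $x\in G$ (a $2$-PCayley graph of $G$). $R(g):x_i\mapsto(xg)_i$, $R(G)=\{R(g)\}$; $N$ is the normalizer of $R(G)$ in the symmetric group on $G_1\cup G_2$ and $K$ the kernel of $N$ acting on $\{G_1,G_2\}$. A $2$-PCayley graph $\Gamma$ of $G$ is $2$PCI (resp. K$2$PCI) if for every $2$-PCayley graph $\Sigma$ of $G$ such that some isomorphism $\Gamma\to\Sigma$ maps $\{G_1,G_2\}$ to itself, there exists $n\in N$ (resp. $n\in K$) with $\Gamma^n=\Sigma$. -}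

module Defs where

open import Level using (Level; _⊔_)
open import Data.Nat using (ℕ)
open import Data.Fin using (Fin)
open import Data.Bool using (Bool; true; false; not)
open import Data.Sum using (_⊎_; inj₁; inj₂)
open import Data.Product using (Σ; _×_; _,_; ∃)
open import Function.Bundles using (_↔_; Inverse)
open import Relation.Binary.PropositionalEquality using (_≡_)
open import Algebra.Structures using (IsAbelianGroup)

record FiniteAbelianGroup (ℓ : Level) : Set (Level.suc ℓ) where
  field
    Carrier        : Set ℓ
    _∙_            : Carrier → Carrier → Carrier
    ε              : Carrier
    _⁻¹            : Carrier → Carrier
    isAbelianGroup : IsAbelianGroup _≡_ _∙_ ε _⁻¹
    size           : ℕ
    enumeration    : Carrier ↔ Fin size
  infixl 7 _∙_
  infix 8 _⁻¹

module _ {ℓ : Level} (G : FiniteAbelianGroup ℓ) where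
  open FiniteAbelianGroup G

  Subset : Set ℓ
  Subset = Carrier → Bool

  -- Vertex set G₁ ∪ G₂ : inj₁ x = x₁ , inj₂ x = x₂.
  Vertex : Set ℓ
  Vertex = Carrier ⊎ Carrier

  Graph : Set ℓ
  Graph = Vertex → Vertex → Bool

  -- BCay(G,S): edges {x₁,(sx)₂} for s ∈ S, x ∈ G, i.e. x₁ ~ y₂ iff y x⁻¹ ∈ S.
  BCay : Subset → Graph
  BCay S (inj₁ x) (inj₂ y) = S (y ∙ x ⁻¹)
  BCay S (inj₂ y) (inj₁ x) = S (y ∙ x ⁻¹)
  BCay S (inj₁ _) (inj₁ _) = false
  BCay S (inj₂ _) (inj₂ _) = false

  -- The 2-PCayley graphs of G are exactly the graphs BCay(G,T), T ⊆ G.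
  Is2PCayley : Graph → Set ℓ
  Is2PCayley Σg = ∃ λ T → ∀ u v → Σg u v ≡ BCay T u v

  side : Vertex → Bool
  side (inj₁ _) = true
  side (inj₂ _) = false

  Perm : Set ℓ
  Perm = Vertex ↔ Vertex

  app : Perm → Vertex → Vertex
  app n = Inverse.to n

  appInv : Perm → Vertex → Vertex
  appInv n = Inverse.from n

  R : Carrier → Vertex → Vertex
  R g (inj₁ x) = inj₁ (x ∙ g)
  R g (inj₂ x) = inj₂ (x ∙ g)

  -- n lies in the normalizer N of R(G): n⁻¹ R(G) n = R(G).
  InN : Perm → Set ℓ
  InN n = (∀ g → ∃ λ h → ∀ v → appInv n (R g (app n v)) ≡ R h v)
        × (∀ h → ∃ λ g → ∀ v → appInv n (R g (app n v)) ≡ R h v)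

  InK : Perm → Set ℓ
  InK n = InN n × (∀ v → side (app n v) ≡ side v)

  ImageEq : Graph → Perm → Graph → Set ℓ
  ImageEq Γ n Σg = ∀ u v → Γ u v ≡ Σg (app n u) (app n v)

  PartIso : Graph → Graph → Set ℓ
  PartIso Γ Σg = Σ Perm λ φ →
      (∀ u v → Γ u v ≡ Σg (app φ u) (app φ v))
    × ((∀ v → side (app φ v) ≡ side v) ⊎ (∀ v → side (app φ v) ≡ not (side v)))

  Is2PCI : Graph → Set ℓ
  Is2PCI Γ = ∀ Σg → Is2PCayley Σg → PartIso Γ Σg →
             Σ Perm λ n → InN n × ImageEq Γ n Σg

  IsK2PCI : Graph → Set ℓ
  IsK2PCI Γ = ∀ Σg → Is2PCayley Σg → PartIso Γ Σg →
              Σ Perm λ n → InK n × ImageEq Γ n Σg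

module Submission where

open import Defs
open import Level using (Level)
open import Function.Bundles using (_⇔_; mk⇔; Inverse; mk↔ₛ′)
open import Function.Construct.Composition using (_↔-∘_)
open import Data.Bool using (Bool; true; false; not)
open import Data.Bool.Properties using (not-involutive; not-¬)
open import Data.Sum using (_⊎_; inj₁; inj₂)
open import Data.Product using (Σ; _×_; _,_; ∃)
open import Relation.Nullary using (¬_)
open import Data.Empty using (⊥-elim)
open import Relation.Binary.PropositionalEquality
open import Algebra.Bundles using (AbelianGroup)
open import Algebra.Structures using (IsAbelianGroup)
import Algebra.Properties.AbelianGroup as AbelianGroupProperties

-- Every element of N either fixes both parts or swaps them, since it maps
-- R(G)-orbits (which are exactly G₁ and G₂) to R(G)-orbits. If it swaps
-- them, compose it with the part-swapping inversion ι : x₁ ↦ (x⁻¹)₂,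
-- x₂ ↦ (x⁻¹)₁; for abelian G, ι is an automorphism of every BCay(G,S) and
-- normalises R(G), so the composite lies in K and still maps BCay(G,S) onto Σ.

module _ {ℓ : Level} (G : FiniteAbelianGroup ℓ) where
  open FiniteAbelianGroup G

  private
    abelianGroup : AbelianGroup ℓ ℓ
    abelianGroup = record { isAbelianGroup = isAbelianGroup }

  open AbelianGroupProperties abelianGroup using (⁻¹-involutive; ⁻¹-anti-homo-\\)
  open IsAbelianGroup isAbelianGroup using (identityˡ; comm)

  side-R : ∀ g v → side G (R G g v) ≡ side G v
  side-R g (inj₁ _) = refl
  side-R g (inj₂ _) = refl

  app-appInv : (n : Perm G) → ∀ w → app G n (appInv G n w) ≡ w
  app-appInv n = Inverse.strictlyInverseˡ n

  InN-∘ : ∀ m n → InN G m → InN G n → InN G (n ↔-∘ m)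
  InN-∘ m n (m-fwd , m-bwd) (n-fwd , n-bwd) = fwd , bwd
    where
    fwd : ∀ g → ∃ λ h → ∀ v → appInv G m (appInv G n (R G g (app G n (app G m v)))) ≡ R G h v
    fwd g with n-fwd g
    ... | k , n-eq with m-fwd k
    ...   | h , m-eq = h , λ v → trans (cong (appInv G m) (n-eq (app G m v))) (m-eq v)
    bwd : ∀ h → ∃ λ g → ∀ v → appInv G m (appInv G n (R G g (app G n (app G m v)))) ≡ R G h v
    bwd h with m-bwd h
    ... | k , m-eq with n-bwd k
    ...   | g , n-eq = g , λ v → trans (cong (appInv G m) (n-eq (app G m v))) (m-eq v)

  app-R-conjugate : ∀ n → InN G n → ∀ h → ∃ λ g → ∀ v → app G n (R G h v) ≡ R G g (app G n v)
  app-R-conjugate n (_ , bwd) h with bwd h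
  ... | g , eq = g , λ v → trans (cong (app G n) (sym (eq v))) (app-appInv n _)

  side-app-R : ∀ n → InN G n → ∀ h v → side G (app G n (R G h v)) ≡ side G (app G n v)
  side-app-R n nN h v with app-R-conjugate n nN h
  ... | g , eq = trans (cong (side G) (eq v)) (side-R g _)

  side-app-inj₁ : ∀ n → InN G n → ∀ x → side G (app G n (inj₁ x)) ≡ side G (app G n (inj₁ ε))
  side-app-inj₁ n nN x =
    trans (cong (λ y → side G (app G n (inj₁ y))) (sym (identityˡ x))) (side-app-R n nN x (inj₁ ε))

  side-app-inj₂ : ∀ n → InN G n → ∀ x → side G (app G n (inj₂ x)) ≡ side G (app G n (inj₂ ε))
  side-app-inj₂ n nN x =
    trans (cong (λ y → side G (app G n (inj₂ y))) (sym (identityˡ x))) (side-app-R n nN x (inj₂ ε))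

  side-app-nonconstant : (n : Perm G) (b : Bool) → ¬ (∀ v → side G (app G n v) ≡ b)
  side-app-nonconstant n b constant =
    not-¬ (trans (cong (side G) (sym (app-appInv n w))) (constant (appInv G n w))) (side-onSide (not b))
    where
    onSide : Bool → Vertex G
    onSide true  = inj₁ ε
    onSide false = inj₂ ε
    side-onSide : ∀ c → side G (onSide c) ≡ c
    side-onSide true  = refl
    side-onSide false = refl
    w : Vertex G
    w = onSide (not b)

  InN⇒fixes⊎swaps-parts : ∀ n → InN G n →
    (∀ v → side G (app G n v) ≡ side G v) ⊎ (∀ v → side G (app G n v) ≡ not (side G v))
  InN⇒fixes⊎swaps-parts n nN
    with side G (app G n (inj₁ ε)) in e₁ | side G (app G n (inj₂ ε)) in e₂
  ... | true  | false = inj₁ λ { (inj₁ x) → trans (side-app-inj₁ n nN x) e₁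
                               ; (inj₂ x) → trans (side-app-inj₂ n nN x) e₂ }
  ... | false | true  = inj₂ λ { (inj₁ x) → trans (side-app-inj₁ n nN x) e₁
                               ; (inj₂ x) → trans (side-app-inj₂ n nN x) e₂ }
  ... | true  | true  = ⊥-elim (side-app-nonconstant n true
                          λ { (inj₁ x) → trans (side-app-inj₁ n nN x) e₁
                            ; (inj₂ x) → trans (side-app-inj₂ n nN x) e₂ })
  ... | false | false = ⊥-elim (side-app-nonconstant n false
                          λ { (inj₁ x) → trans (side-app-inj₁ n nN x) e₁
                            ; (inj₂ x) → trans (side-app-inj₂ n nN x) e₂ })

  ι-fun : Vertex G → Vertex G
  ι-fun (inj₁ x) = inj₂ (x ⁻¹)
  ι-fun (inj₂ x) = inj₁ (x ⁻¹)

  ι-involutive : ∀ v → ι-fun (ι-fun v) ≡ v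
  ι-involutive (inj₁ x) = cong inj₁ (⁻¹-involutive x)
  ι-involutive (inj₂ x) = cong inj₂ (⁻¹-involutive x)

  ι : Perm G
  ι = mk↔ₛ′ ι-fun ι-fun ι-involutive ι-involutive

  side-ι : ∀ v → side G (app G ι v) ≡ not (side G v)
  side-ι (inj₁ _) = refl
  side-ι (inj₂ _) = refl

  [x⁻¹∙g]⁻¹≡x∙g⁻¹ : ∀ x g → (x ⁻¹ ∙ g) ⁻¹ ≡ x ∙ g ⁻¹
  [x⁻¹∙g]⁻¹≡x∙g⁻¹ x g = trans (⁻¹-anti-homo-\\ x g) (comm (g ⁻¹) x)

  ι-R-ι : ∀ g v → ι-fun (R G g (ι-fun v)) ≡ R G (g ⁻¹) v
  ι-R-ι g (inj₁ x) = cong inj₁ ([x⁻¹∙g]⁻¹≡x∙g⁻¹ x g)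
  ι-R-ι g (inj₂ x) = cong inj₂ ([x⁻¹∙g]⁻¹≡x∙g⁻¹ x g)

  ι-InN : InN G ι
  ι-InN = (λ g → g ⁻¹ , ι-R-ι g)
        , (λ h → h ⁻¹ , λ v → trans (ι-R-ι (h ⁻¹) v) (cong (λ g → R G g v) (⁻¹-involutive h)))

  BCay-ι-invariant : (S : Subset G) → ∀ u v → BCay G S u v ≡ BCay G S (app G ι u) (app G ι v)
  BCay-ι-invariant S (inj₁ x) (inj₁ y) = refl
  BCay-ι-invariant S (inj₁ x) (inj₂ y) = cong S (y∙x⁻¹≡x⁻¹∙y⁻¹⁻¹ x y)
    where
    y∙x⁻¹≡x⁻¹∙y⁻¹⁻¹ : ∀ x y → y ∙ x ⁻¹ ≡ x ⁻¹ ∙ y ⁻¹ ⁻¹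
    y∙x⁻¹≡x⁻¹∙y⁻¹⁻¹ x y = trans (comm y (x ⁻¹)) (cong (x ⁻¹ ∙_) (sym (⁻¹-involutive y)))
  BCay-ι-invariant S (inj₂ y) (inj₁ x) = BCay-ι-invariant S (inj₁ x) (inj₂ y)
  BCay-ι-invariant S (inj₂ x) (inj₂ y) = refl

  BCay-image-by-N⇒by-K : (S : Subset G) (Σg : Graph G) (n : Perm G) → InN G n →
    ImageEq G (BCay G S) n Σg → Σ (Perm G) λ m → InK G m × ImageEq G (BCay G S) m Σg
  BCay-image-by-N⇒by-K S Σg n nN image with InN⇒fixes⊎swaps-parts n nN
  ... | inj₁ fixes = n , (nN , fixes) , image
  ... | inj₂ swaps = n ↔-∘ ι , (InN-∘ ι n ι-InN nN , fixes) , image′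
    where
    fixes : ∀ v → side G (app G n (app G ι v)) ≡ side G v
    fixes v = trans (swaps (app G ι v)) (trans (cong not (side-ι v)) (not-involutive (side G v)))
    image′ : ImageEq G (BCay G S) (n ↔-∘ ι) Σg
    image′ u v = trans (BCay-ι-invariant S u v) (image (app G ι u) (app G ι v))

corollary3p4 : {ℓ : Level} (G : FiniteAbelianGroup ℓ) (S : Subset G) →
    Is2PCI G (BCay G S) ⇔ IsK2PCI G (BCay G S)
corollary3p4 G S = mk⇔ 2PCI⇒K2PCI K2PCI⇒2PCI
  where
  2PCI⇒K2PCI : Is2PCI G (BCay G S) → IsK2PCI G (BCay G S)
  2PCI⇒K2PCI 2pci Σg cayley iso with 2pci Σg cayley iso
  ... | n , nN , image = BCay-image-by-N⇒by-K G S Σg n nN image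
  K2PCI⇒2PCI : IsK2PCI G (BCay G S) → Is2PCI G (BCay G S)
  K2PCI⇒2PCI k2pci Σg cayley iso with k2pci Σg cayley iso
  ... | n , (nN , _) , image = n , nN , image
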